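{- Every Sahlqvist formula has a computable, first-order, global correspondent on frames: there is an effective procedure which assigns to every Sahlqvist formula $\phi$ a first-order sentence $\alpha_\phi$ in the language with equality, binary predicates $\le$, $R$ and a constant $\mathfrak{ff}$, such that for every CK-frame $\mathcal{X}=(X,\text{bomb},\le,R)$, we have $\mathcal{X}\Vdash\phi$ if and only if the first-order structure with domain $X$ interpreting $\le,R$ by the frame relations and $\mathfrak{ff}$ by $\text{bomb}$ satisfies $\alpha_\phi$.
   Context: Formulas: for a set $\mathrm{Prop}$ of propositional variables, formulas are given by $\phi::=p\mid\bot\mid\phi\wedge\phi\mid\phi\vee\phi\mid\phi\to\phi\mid\Box\phi\mid\Diamond\phi$, with $\top:=\bot\to\bot$. A CK-frame is $(X,\text{bomb},\le,R)$ where $\le$ is a preorder on $X$, $\text{bomb}\in X$ is $\le$-maximal, and $R\subseteq X\times X$ satisfies: $\text{bomb}\,R\,x$ iff $x=\text{bomb}$. $\mathrm{Up}(X)$ is the set of $\le$-upsets containing $\text{bomb}$. A valuation is $V:\mathrm{Prop}\to\mathrm{Up}(X)$, extended by $V(\bot)=\{\text{bomb}\}$, $V(\phi\wedge\psi)=V(\phi)\cap V(\psi)$, $V(\phi\vee\psi)=V(\phi)\cup V(\psi)$, $V(\phi\to\psi)=\{x:\forall y(x\le y,\ y\in V(\phi)\Rightarrow y\in V(\psi))\}$, $V(\Box\phi)=\{x:\forall y,z(x\le y\,R\,z\Rightarrow z\in V(\phi))\}$, $V(\Diamond\phi)=\{x:\forall y(x\le y\Rightarrow\exists z(yRz,\ z\in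 V(\phi)))\}$. $\mathcal{X}\Vdash\phi$ means $V(\phi)=X$ for every valuation $V$. A formula is positive if built from propositional variables, $\top,\bot,\wedge,\vee,\Box,\Diamond$. A boxed atom is $\Box^n p$ ($n\ge 0$ boxes before a variable $p$). A Sahlqvist antecedent is built from boxed atoms using $\top,\bot,\wedge,\vee$. A Sahlqvist formula is an implication $\phi\to\psi$ with $\phi$ a Sahlqvist antecedent and $\psi$ positive. -}

module Defs where

open import Data.Nat using (ℕ; zero; suc)
open import Data.Fin using (Fin; zero; suc)
open import Data.Empty using (⊥)
open import Data.Product using (Σ; _×_; _,_)
open import Data.Sum using (_⊎_)
open import Relation.Binary.PropositionalEquality using (_≡_)
open import Level using (Level; 0ℓ) renaming (suc to lsuc)

data Fm : Set where
  var  : ℕ → Fm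
  ⊥'   : Fm
  _∧'_ : Fm → Fm → Fm
  _∨'_ : Fm → Fm → Fm
  _⇒'_ : Fm → Fm → Fm
  □'   : Fm → Fm
  ◇'   : Fm → Fm

⊤' : Fm
⊤' = ⊥' ⇒' ⊥'

data IsPositive : Fm → Set where
  pos-var : ∀ p → IsPositive (var p)
  pos-⊤   : IsPositive ⊤'
  pos-⊥   : IsPositive ⊥'
  pos-∧   : ∀ {φ ψ} → IsPositive φ → IsPositive ψ → IsPositive (φ ∧' ψ)
  pos-∨   : ∀ {φ ψ} → IsPositive φ → IsPositive ψ → IsPositive (φ ∨' ψ)
  pos-□   : ∀ {φ} → IsPositive φ → IsPositive (□' φ)
  pos-◇   : ∀ {φ} → IsPositive φ → IsPositive (◇' φ)

□^ : ℕ → Fm → Fm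
□^ zero    φ = φ
□^ (suc n) φ = □' (□^ n φ)

data IsBoxedAtom : Fm → Set where
  boxed : ∀ n p → IsBoxedAtom (□^ n (var p))

data IsSahlqvistAnte : Fm → Set where
  ante-atom : ∀ {φ} → IsBoxedAtom φ → IsSahlqvistAnte φ
  ante-⊤    : IsSahlqvistAnte ⊤'
  ante-⊥    : IsSahlqvistAnte ⊥'
  ante-∧    : ∀ {φ ψ} → IsSahlqvistAnte φ → IsSahlqvistAnte ψ → IsSahlqvistAnte (φ ∧' ψ)
  ante-∨    : ∀ {φ ψ} → IsSahlqvistAnte φ → IsSahlqvistAnte ψ → IsSahlqvistAnte (φ ∨' ψ)

data IsSahlqvist : Fm → Set where
  sahlqvist : ∀ {φ ψ} → IsSahlqvistAnte φ → IsPositive ψ → IsSahlqvist (φ ⇒' ψ)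

record CKFrame : Set₁ where
  field
    X        : Set
    bomb     : X
    _≤_      : X → X → Set
    R        : X → X → Set
    ≤-refl   : ∀ {x} → x ≤ x
    ≤-trans  : ∀ {x y z} → x ≤ y → y ≤ z → x ≤ z
    bomb-max : ∀ {x} → bomb ≤ x → x ≡ bomb
    bombR→   : ∀ {x} → R bomb x → x ≡ bomb
    bombR←   : R bomb bomb

module _ (𝓧 : CKFrame) where
  open CKFrame 𝓧

  record Upset : Set₁ where
    field
      mem     : X → Set
      up      : ∀ {x y} → x ≤ y → mem x → mem y
      hasBomb : mem bomb

  Valuation : Set₁
  Valuation = ℕ → Upset

  ⟦_⟧ : Fm → Valuation → X → Set
  ⟦ var p ⟧  V x = Upset.mem (V p) x
  ⟦ ⊥' ⟧     V x = x ≡ bomb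
  ⟦ φ ∧' ψ ⟧ V x = ⟦ φ ⟧ V x × ⟦ ψ ⟧ V x
  ⟦ φ ∨' ψ ⟧ V x = ⟦ φ ⟧ V x ⊎ ⟦ ψ ⟧ V x
  ⟦ φ ⇒' ψ ⟧ V x = ∀ y → x ≤ y → ⟦ φ ⟧ V y → ⟦ ψ ⟧ V y
  ⟦ □' φ ⟧   V x = ∀ y z → x ≤ y → R y z → ⟦ φ ⟧ V z
  ⟦ ◇' φ ⟧   V x = ∀ y → x ≤ y → Σ X (λ z → R y z × ⟦ φ ⟧ V z)

  _⊩_ : Fm → Set₁
  _⊩_ φ = ∀ (V : Valuation) (x : X) → ⟦ φ ⟧ V x

-- First-order language with =, binary ≤, R, constant ff
-- (de Bruijn variables; FO n = formulas with n free variables)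

data Term (n : ℕ) : Set where
  v  : Fin n → Term n
  ff : Term n

data FO (n : ℕ) : Set where
  _≐_  : Term n → Term n → FO n
  _≼_  : Term n → Term n → FO n
  rel  : Term n → Term n → FO n
  fo⊥  : FO n
  _∧ᶠ_ : FO n → FO n → FO n
  _∨ᶠ_ : FO n → FO n → FO n
  _⇒ᶠ_ : FO n → FO n → FO n
  ∀ᶠ   : FO (suc n) → FO n
  ∃ᶠ   : FO (suc n) → FO n

Sentence : Set
Sentence = FO zero

module _ (𝓧 : CKFrame) where
  open CKFrame 𝓧

  ext : ∀ {n} → (Fin n → X) → X → Fin (suc n) → X
  ext ρ a zero    = a
  ext ρ a (suc i) = ρ i

  evalT : ∀ {n} → (Fin n → X) → Term n → X
  evalT ρ (v i) = ρ i
  evalT ρ ff    = bomb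

  Sat : ∀ {n} → (Fin n → X) → FO n → Set
  Sat ρ (s ≐ t)  = evalT ρ s ≡ evalT ρ t
  Sat ρ (s ≼ t)  = evalT ρ s ≤ evalT ρ t
  Sat ρ (rel s t) = R (evalT ρ s) (evalT ρ t)
  Sat ρ fo⊥      = ⊥
  Sat ρ (α ∧ᶠ β) = Sat ρ α × Sat ρ β
  Sat ρ (α ∨ᶠ β) = Sat ρ α ⊎ Sat ρ β
  Sat ρ (α ⇒ᶠ β) = Sat ρ α → Sat ρ β
  Sat ρ (∀ᶠ α)   = ∀ (a : X) → Sat (ext ρ a) α
  Sat ρ (∃ᶠ α)   = Σ X (λ a → Sat (ext ρ a) α)

  _⊨_ : Sentence → Set
  _⊨_ α = Sat (λ ()) α

{-# OPTIONS --safe #-}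
module Submission where

-- Away from bomb, where every formula holds, a Sahlqvist antecedent is a disjunction of
-- conjunctions of boxed atoms □^m p, so φ ⇒ ψ is valid iff each such conjunction implies ψ.
-- Given a conjunction and a point y there is a least valuation making it true at y: p is
-- sent to bomb together with the endpoints of (≤ ; R)^m ; ≤ paths from y, one m for each
-- conjunct □^m p. The consequent ψ is positive, hence monotone in the valuation, so the
-- conjunction implies ψ iff ψ holds at every y under that least valuation. That valuation is
-- first-order definable from y, and substituting its definition into the standard
-- translation of ψ gives the correspondent.

open import Defs
open import Data.Fin using (Fin; zero; suc)
open import Data.List using (List; []; _∷_; [_]; _++_; map; filter; cartesianProductWith)
open import Data.List.Membership.Propositional using (_∈_; find; lose)
open import Data.List.Membership.Propositional.Properties using (∈-map⁺; ∈-map⁻; ∈-filter⁺; ∈-filter⁻)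
open import Data.List.Relation.Unary.All as All using (All; []; _∷_)
import Data.List.Relation.Unary.All.Properties as All
open import Data.List.Relation.Unary.Any as Any using (Any; here; there)
import Data.List.Relation.Unary.Any.Properties as Any
open import Data.Nat using (ℕ; zero; suc; _≟_)
open import Data.Product using (Σ; ∃-syntax; _×_; _,_; proj₁; proj₂)
open import Data.Product.Function.Dependent.Propositional using (congˡ)
open import Data.Product.Function.NonDependent.Propositional using (_×-⇔_)
open import Data.Sum using (_⊎_; inj₁; inj₂; [_,_]′)
import Data.Sum as Sum
open import Data.Sum.Function.Propositional using (_⊎-⇔_)
open import Function using (_∘_)
open import Function.Bundles using (_⇔_; mk⇔; Equivalence)
open import Function.Construct.Identity using (⇔-id)
open import Function.Construct.Symmetry using (⇔-sym)
open import Function.Related.Propositional using (equivalence; module EquationalReasoning)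
open import Function.Related.TypeIsomorphisms using (→-cong-⇔)
open import Level using (Level)
open import Relation.Binary.PropositionalEquality using (_≡_; refl)

open Equivalence using (to; from)

private
  variable
    a b c : Level
    n : ℕ

Π-⇔ : {A : Set a} {P : A → Set b} {Q : A → Set c} →
      (∀ x → P x ⇔ Q x) → ((x : A) → P x) ⇔ ((x : A) → Q x)
Π-⇔ P⇔Q = mk⇔ (λ f x → to (P⇔Q x) (f x)) (λ g x → from (P⇔Q x) (g x))

All-⇔ : {A : Set a} {P : A → Set b} {Q : A → Set c} {xs : List A} →
        (∀ x → P x ⇔ Q x) → All P xs ⇔ All Q xs
All-⇔ P⇔Q = mk⇔ (All.map (to (P⇔Q _))) (All.map (from (P⇔Q _)))

⊤ᶠ : FO n
⊤ᶠ = fo⊥ ⇒ᶠ fo⊥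

⋀ᶠ : List (FO n) → FO n
⋀ᶠ []       = ⊤ᶠ
⋀ᶠ (α ∷ αs) = α ∧ᶠ ⋀ᶠ αs

⋁ᶠ : List (FO n) → FO n
⋁ᶠ []       = fo⊥
⋁ᶠ (α ∷ αs) = α ∨ᶠ ⋁ᶠ αs

-- (m , p) stands for the boxed atom □^ m (var p).
Atom : Set
Atom = ℕ × ℕ

depthsOf : ℕ → List Atom → List ℕ
depthsOf p = map proj₁ ∘ filter (λ atom → proj₂ atom ≟ p)

∈-depthsOf⁺ : ∀ {m p as} → (m , p) ∈ as → m ∈ depthsOf p as
∈-depthsOf⁺ {p = p} m,p∈as = ∈-map⁺ proj₁ (∈-filter⁺ (λ atom → proj₂ atom ≟ p) m,p∈as refl)

∈-depthsOf⁻ : ∀ {m p} as → m ∈ depthsOf p as → (m , p) ∈ as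
∈-depthsOf⁻ {p = p} as m∈ with ∈-map⁻ proj₁ m∈
... | _ , atom∈ , refl with ∈-filter⁻ (λ atom → proj₂ atom ≟ p) {xs = as} atom∈
...   | atom∈as , refl = atom∈as

-- ⟦ ⊥' ⟧ is {bomb}, not ∅, so the empty disjunction describes ⊥' only away from bomb
-- (see dnf-complete).
dnf : ∀ {φ} → IsSahlqvistAnte φ → List (List Atom)
dnf (ante-atom (boxed m p)) = [ [ (m , p) ] ]
dnf ante-⊤                  = [ [] ]
dnf ante-⊥                  = []
dnf (ante-∧ A B)            = cartesianProductWith _++_ (dnf A) (dnf B)
dnf (ante-∨ A B)            = dnf A ++ dnf B

PathF : ℕ → Fin n → Fin n → FO n
PathF zero    x z = v x ≼ v z
PathF (suc m) x z =
  ∃ᶠ (∃ᶠ ((v (suc (suc x)) ≼ v (suc zero)) ∧ᶠ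
          (rel (v (suc zero)) (v zero) ∧ᶠ PathF m zero (suc (suc z)))))

MinValF : List Atom → Fin n → ℕ → Fin n → FO n
MinValF as y p z = (v z ≐ ff) ∨ᶠ ⋁ᶠ (map (λ m → PathF m y z) (depthsOf p as))

ST : List Atom → Fin n → Fm → Fin n → FO n
ST as y (var p)  x = MinValF as y p x
ST as y ⊥'       x = v x ≐ ff
ST as y (φ ∧' ψ) x = ST as y φ x ∧ᶠ ST as y ψ x
ST as y (φ ∨' ψ) x = ST as y φ x ∨ᶠ ST as y ψ x
ST as y (φ ⇒' ψ) x =
  ∀ᶠ ((v (suc x) ≼ v zero) ⇒ᶠ (ST as (suc y) φ zero ⇒ᶠ ST as (suc y) ψ zero))
ST as y (□' φ)   x =
  ∀ᶠ (∀ᶠ ((v (suc (suc x)) ≼ v (suc zero)) ⇒ᶠ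
          (rel (v (suc zero)) (v zero) ⇒ᶠ ST as (suc (suc y)) φ zero)))
ST as y (◇' φ)   x =
  ∀ᶠ ((v (suc x) ≼ v zero) ⇒ᶠ ∃ᶠ (rel (v (suc zero)) (v zero) ∧ᶠ ST as (suc (suc y)) φ zero))

correspondent : (φ : Fm) → IsSahlqvist φ → Sentence
correspondent _ (sahlqvist {ψ = ψ} A _) = ⋀ᶠ (map (λ as → ∀ᶠ (ST as zero ψ zero)) (dnf A))

module _ (𝓧 : CKFrame) where
  open CKFrame 𝓧
  open Upset

  ⟦_⟧ₓ : Fm → Valuation 𝓧 → X → Set
  ⟦_⟧ₓ = ⟦_⟧ 𝓧

  Sat-⋀ᶠ : ∀ {ρ : Fin n → X} αs → Sat 𝓧 ρ (⋀ᶠ αs) ⇔ All (Sat 𝓧 ρ) αs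
  Sat-⋀ᶠ []       = mk⇔ (λ _ → []) (λ _ ())
  Sat-⋀ᶠ (α ∷ αs) = mk⇔ (λ (h , hs) → h ∷ to (Sat-⋀ᶠ αs) hs)
                        (λ { (h ∷ hs) → h , from (Sat-⋀ᶠ αs) hs })

  Sat-⋁ᶠ : ∀ {ρ : Fin n → X} αs → Sat 𝓧 ρ (⋁ᶠ αs) ⇔ Any (Sat 𝓧 ρ) αs
  Sat-⋁ᶠ []       = mk⇔ (λ ()) (λ ())
  Sat-⋁ᶠ (α ∷ αs) = mk⇔ [ here , there ∘ to (Sat-⋁ᶠ αs) ]′
                        (λ { (here h) → inj₁ h ; (there h) → inj₂ (from (Sat-⋁ᶠ αs) h) })

  Path : ℕ → X → X → Set
  Path zero    x z = x ≤ z
  Path (suc m) x z = ∃[ y ] ∃[ w ] (x ≤ y × R y w × Path m w z)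

  Path-≤ : ∀ m {x z z′} → Path m x z → z ≤ z′ → Path m x z′
  Path-≤ zero    x≤z                 z≤z′ = ≤-trans x≤z z≤z′
  Path-≤ (suc m) (y , w , x≤y , yRw , π) z≤z′ = y , w , x≤y , yRw , Path-≤ m π z≤z′

  □^-⇔-Path : ∀ m p (V : Valuation 𝓧) x →
              ⟦ □^ m (var p) ⟧ₓ V x ⇔ (∀ z → Path m x z → mem (V p) z)
  □^-⇔-Path zero    p V x = mk⇔ (λ h z x≤z → up (V p) x≤z h) (λ h → h x ≤-refl)
  □^-⇔-Path (suc m) p V x = mk⇔
    (λ h z (y , w , x≤y , yRw , π) → to (□^-⇔-Path m p V w) (h y w x≤y yRw) z π)
    (λ h y w x≤y yRw → from (□^-⇔-Path m p V w) (λ z π → h z (y , w , x≤y , yRw , π)))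

  _⊆ᵛ_ : Valuation 𝓧 → Valuation 𝓧 → Set
  V ⊆ᵛ W = ∀ p x → mem (V p) x → mem (W p) x

  positive-mono : ∀ {ψ} → IsPositive ψ → ∀ {V W} → V ⊆ᵛ W → ∀ x → ⟦ ψ ⟧ₓ V x → ⟦ ψ ⟧ₓ W x
  positive-mono (pos-var p) V⊆W x h             = V⊆W p x h
  positive-mono pos-⊤       V⊆W x h             = h
  positive-mono pos-⊥       V⊆W x h             = h
  positive-mono (pos-∧ P Q) V⊆W x (hφ , hψ)     = positive-mono P V⊆W x hφ , positive-mono Q V⊆W x hψ
  positive-mono (pos-∨ P Q) V⊆W x h             =
    Sum.map (positive-mono P V⊆W x) (positive-mono Q V⊆W x) h
  positive-mono (pos-□ P)   V⊆W x h y z x≤y yRz = positive-mono P V⊆W z (h y z x≤y yRz)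
  positive-mono (pos-◇ P)   V⊆W x h y x≤y       =
    let z , yRz , hz = h y x≤y in z , yRz , positive-mono P V⊆W z hz

  ⟦⟧-bomb : ∀ ψ V → ⟦ ψ ⟧ₓ V bomb
  ⟦⟧-bomb (var p)  V = hasBomb (V p)
  ⟦⟧-bomb ⊥'       V = refl
  ⟦⟧-bomb (φ ∧' ψ) V = ⟦⟧-bomb φ V , ⟦⟧-bomb ψ V
  ⟦⟧-bomb (φ ∨' ψ) V = inj₁ (⟦⟧-bomb φ V)
  ⟦⟧-bomb (φ ⇒' ψ) V y bomb≤y _ with refl ← bomb-max bomb≤y = ⟦⟧-bomb ψ V
  ⟦⟧-bomb (□' φ)   V y z bomb≤y yRz with refl ← bomb-max bomb≤y with refl ← bombR→ yRz =
    ⟦⟧-bomb φ V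
  ⟦⟧-bomb (◇' φ)   V y bomb≤y with refl ← bomb-max bomb≤y = bomb , bombR← , ⟦⟧-bomb φ V

  Holds : List Atom → Valuation 𝓧 → X → Set
  Holds as V y = All (λ (m , p) → ⟦ □^ m (var p) ⟧ₓ V y) as

  minimalValuation : List Atom → X → Valuation 𝓧
  minimalValuation as y p = record
    { mem     = λ z → z ≡ bomb ⊎ Any (λ m → Path m y z) (depthsOf p as)
    ; up      = λ { z≤z′ (inj₁ refl) → inj₁ (bomb-max z≤z′)
                  ; z≤z′ (inj₂ π)    → inj₂ (Any.map (λ {m} π → Path-≤ m π z≤z′) π) }
    ; hasBomb = inj₁ refl
    }

  minimalValuation-holds : ∀ as y → Holds as (minimalValuation as y) y
  minimalValuation-holds as y = All.tabulate λ {(m , p)} m,p∈as →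
    from (□^-⇔-Path m p _ y) (λ z π → inj₂ (lose (∈-depthsOf⁺ m,p∈as) π))

  minimalValuation-least : ∀ as {V y} → Holds as V y → minimalValuation as y ⊆ᵛ V
  minimalValuation-least as {V} holds p z (inj₁ refl) = hasBomb (V p)
  minimalValuation-least as {V} {y} holds p z (inj₂ π) =
    let m , m∈ , π = find π
    in to (□^-⇔-Path m p V y) (All.lookup holds (∈-depthsOf⁻ as m∈)) z π

  Sat-PathF : ∀ m {ρ : Fin n → X} x z → Sat 𝓧 ρ (PathF m x z) ⇔ Path m (ρ x) (ρ z)
  Sat-PathF zero    x z = ⇔-id _
  Sat-PathF (suc m) x z =
    congˡ {k = equivalence} (congˡ {k = equivalence}
      (⇔-id _ ×-⇔ ⇔-id _ ×-⇔ Sat-PathF m zero (suc (suc z))))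

  Sat-MinValF : ∀ as {ρ : Fin n → X} y p z →
                Sat 𝓧 ρ (MinValF as y p z) ⇔ mem (minimalValuation as (ρ y) p) (ρ z)
  Sat-MinValF as y p z = ⇔-id _ ⊎-⇔ mk⇔
    (Any.map (λ {m} → to (Sat-PathF m y z)) ∘ Any.map⁻ ∘ to (Sat-⋁ᶠ _))
    (from (Sat-⋁ᶠ _) ∘ Any.map⁺ ∘ Any.map (λ {m} → from (Sat-PathF m y z)))

  Sat-ST : ∀ as {ρ : Fin n → X} y ψ x →
           Sat 𝓧 ρ (ST as y ψ x) ⇔ ⟦ ψ ⟧ₓ (minimalValuation as (ρ y)) (ρ x)
  Sat-ST as y (var p)  x = Sat-MinValF as y p x
  Sat-ST as y ⊥'       x = ⇔-id _
  Sat-ST as y (φ ∧' ψ) x = Sat-ST as y φ x ×-⇔ Sat-ST as y ψ x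
  Sat-ST as y (φ ∨' ψ) x = Sat-ST as y φ x ⊎-⇔ Sat-ST as y ψ x
  Sat-ST as y (φ ⇒' ψ) x = Π-⇔ λ _ →
    →-cong-⇔ (⇔-id _) (→-cong-⇔ (Sat-ST as (suc y) φ zero) (Sat-ST as (suc y) ψ zero))
  Sat-ST as y (□' φ)   x = Π-⇔ λ _ → Π-⇔ λ _ →
    →-cong-⇔ (⇔-id _) (→-cong-⇔ (⇔-id _) (Sat-ST as (suc (suc y)) φ zero))
  Sat-ST as y (◇' φ)   x = Π-⇔ λ _ →
    →-cong-⇔ (⇔-id _) (congˡ {k = equivalence} (⇔-id _ ×-⇔ Sat-ST as (suc (suc y)) φ zero))

  minimalValuation-correspondence : ∀ {ψ} → IsPositive ψ → ∀ as →
    (∀ V y → Holds as V y → ⟦ ψ ⟧ₓ V y) ⇔ (∀ y → ⟦ ψ ⟧ₓ (minimalValuation as y) y)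
  minimalValuation-correspondence pos as = mk⇔
    (λ h y → h _ y (minimalValuation-holds as y))
    (λ h V y holds → positive-mono pos (minimalValuation-least as holds) y (h y))

  conjunct-correspondence : ∀ {ψ} → IsPositive ψ → ∀ as {ρ : Fin n → X} →
    (∀ V y → Holds as V y → ⟦ ψ ⟧ₓ V y) ⇔ Sat 𝓧 ρ (∀ᶠ (ST as zero ψ zero))
  conjunct-correspondence {ψ = ψ} pos as = begin
    (∀ V y → Holds as V y → ⟦ ψ ⟧ₓ V y)      ∼⟨ minimalValuation-correspondence pos as ⟩
    (∀ y → ⟦ ψ ⟧ₓ (minimalValuation as y) y) ∼⟨ Π-⇔ (λ y → ⇔-sym (Sat-ST as zero ψ zero)) ⟩
    Sat 𝓧 _ (∀ᶠ (ST as zero ψ zero))         ∎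
    where open EquationalReasoning {k = equivalence}

  dnf-sound : ∀ {φ} (A : IsSahlqvistAnte φ) {V y} →
              Any (λ as → Holds as V y) (dnf A) → ⟦ φ ⟧ₓ V y
  dnf-sound (ante-atom (boxed m p)) (here (h ∷ [])) = h
  dnf-sound ante-⊤                  _               = λ _ _ e → e
  dnf-sound (ante-∧ A B)            h               =
    let hA , hB = Any.cartesianProductWith⁻ _++_ (λ {as} → All.++⁻ as) (dnf A) (dnf B) h
    in dnf-sound A hA , dnf-sound B hB
  dnf-sound (ante-∨ A B)            h               =
    Sum.map (dnf-sound A) (dnf-sound B) (Any.++⁻ (dnf A) h)

  dnf-complete : ∀ {φ} (A : IsSahlqvistAnte φ) {V y} → ⟦ φ ⟧ₓ V y →
                 y ≡ bomb ⊎ Any (λ as → Holds as V y) (dnf A)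
  dnf-complete (ante-atom (boxed m p)) h        = inj₂ (here (h ∷ []))
  dnf-complete ante-⊤                  _        = inj₂ (here [])
  dnf-complete ante-⊥                  y≡bomb   = inj₁ y≡bomb
  dnf-complete (ante-∧ A B)            (hA , hB) with dnf-complete A hA | dnf-complete B hB
  ... | inj₁ y≡bomb | _           = inj₁ y≡bomb
  ... | inj₂ _      | inj₁ y≡bomb = inj₁ y≡bomb
  ... | inj₂ anyA   | inj₂ anyB   = inj₂ (Any.cartesianProductWith⁺ _++_ All.++⁺ anyA anyB)
  dnf-complete (ante-∨ A B)            (inj₁ h) = Sum.map₂ Any.++⁺ˡ (dnf-complete A h)
  dnf-complete (ante-∨ A B)            (inj₂ h) = Sum.map₂ (Any.++⁺ʳ (dnf A)) (dnf-complete B h)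

  implication-⇔-dnf : ∀ {φ} (A : IsSahlqvistAnte φ) ψ →
                      (∀ V y → ⟦ φ ⟧ₓ V y → ⟦ ψ ⟧ₓ V y) ⇔
                      All (λ as → ∀ V y → Holds as V y → ⟦ ψ ⟧ₓ V y) (dnf A)
  implication-⇔-dnf {φ} A ψ = mk⇔
    (λ φ⇒ψ → All.tabulate λ as∈ V y holds → φ⇒ψ V y (dnf-sound A (lose as∈ holds)))
    from-dnf
    where
    from-dnf : All (λ as → ∀ V y → Holds as V y → ⟦ ψ ⟧ₓ V y) (dnf A) →
               ∀ V y → ⟦ φ ⟧ₓ V y → ⟦ ψ ⟧ₓ V y
    from-dnf all V y hφ with dnf-complete A hφ
    ... | inj₁ refl = ⟦⟧-bomb ψ V
    ... | inj₂ any  = let as⇒ψ , holds = All.lookupAny all any in as⇒ψ V y holds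

  ⊩-⇒ : ∀ φ ψ → 𝓧 ⊩ (φ ⇒' ψ) ⇔ (∀ V y → ⟦ φ ⟧ₓ V y → ⟦ ψ ⟧ₓ V y)
  ⊩-⇒ _ _ = mk⇔ (λ h V y → h V y y ≤-refl) (λ h V _ y _ → h V y)

  sahlqvist-correspondence : ∀ φ (s : IsSahlqvist φ) → 𝓧 ⊩ φ ⇔ 𝓧 ⊨ correspondent φ s
  -- `𝓧 ⊨ α` evaluates α in an absurd environment `λ ()` whose elaboration depends on α, so
  -- the conjuncts are stated with `Sat 𝓧 _` and that environment is left to unification.
  sahlqvist-correspondence _ (sahlqvist {φ} {ψ} A pos) = begin
    𝓧 ⊩ (φ ⇒' ψ)                                              ∼⟨ ⊩-⇒ φ ψ ⟩
    (∀ V y → ⟦ φ ⟧ₓ V y → ⟦ ψ ⟧ₓ V y)                         ∼⟨ implication-⇔-dnf A ψ ⟩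
    All (λ as → ∀ V y → Holds as V y → ⟦ ψ ⟧ₓ V y) (dnf A)    ∼⟨ All-⇔ (λ as → conjunct-correspondence pos as) ⟩
    All (λ as → Sat 𝓧 _ (∀ᶠ (ST as zero ψ zero))) (dnf A)     ∼⟨ mk⇔ All.map⁺ All.map⁻ ⟩
    All (Sat 𝓧 _) (map (λ as → ∀ᶠ (ST as zero ψ zero)) (dnf A)) ∼⟨ ⇔-sym (Sat-⋀ᶠ _) ⟩
    𝓧 ⊨ correspondent (φ ⇒' ψ) (sahlqvist A pos)              ∎
    where open EquationalReasoning {k = equivalence}

theorem4p9 : Σ ((φ : Fm) → IsSahlqvist φ → Sentence)
               (λ α → ∀ (φ : Fm) (s : IsSahlqvist φ) (𝓧 : CKFrame)
                        → (_⊩_ 𝓧 φ) ⇔ (_⊨_ 𝓧 (α φ s)))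
theorem4p9 = correspondent , λ φ s 𝓧 → sahlqvist-correspondence 𝓧 φ s
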